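{- Let $\mathcal{F}=\langle W,R,\{S_w\}_{w\in W}\rangle$ be a Veltman frame, let $f,g,h$ be ultrafilters on $W$, and let $l,m\subseteq\wp(W)\setminus\{\emptyset\}$ each have the finite intersection property. If $f\prec_l g$ and $g\prec_m h$, then $f\prec_l h$.
   Context: A Veltman frame is $\langle W,R,\{S_w\}\rangle$ where: - $W$ is nonempty. - $R$ is transitive and conversely well-founded. - Each $S_w$ is a reflexive transitive relation on $R[w]=\{v:wRv\}$ containing $R\cap R[w]^2$. For $X,Y\subseteq W$: - $\overline{Y}=W\setminus Y$. - $\widehat{R^{ -1}}(Y)=\{x:\forall y(xRy\to y\in Y)\}$. - $S^{ -1}(X,Y)=\{w:\forall x\in X(wRx\to\exists y\in Y\,xS_wy)\}$. For a family $l\subseteq\wp(W)$ and ultrafilters $f,g$, $f\prec_l g$ means the following: for every $A\subseteq W$ and every finite (possibly empty) family $S_1,\dots,S_n\in l$, if $S^{ -1}(\overline{A},\overline{S_1}\cup\dots\cup\overline{S_n})\in f$ then $A\in g$ and $\widehat{R^{ -1}}(A)\in g$. -}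

module Defs where

open import Level using (0ℓ)
open import Data.Product using (Σ; _×_; ∃)
open import Data.Sum using (_⊎_)
open import Data.Empty using (⊥)
open import Data.Unit using (⊤)
open import Data.List using (List; []; _∷_)
open import Data.List.Relation.Unary.All using (All)
open import Relation.Nullary using (¬_)
open import Relation.Unary using (Pred; _⊆_; _∩_; ∁)
open import Induction.WellFounded using (WellFounded)

Subset : Set → Set₁
Subset W = Pred W 0ℓ

-- A Veltman frame ⟨W, R, {S_w}⟩.  S w x y  means  x S_w y.
record VeltmanFrame : Set₁ where
  field
    W        : Set
    nonempty : W
    R        : W → W → Set
    R-trans  : ∀ {x y z} → R x y → R y z → R x z
    R-cwf    : WellFounded (λ x y → R y x)
    S        : W → W → W → Set
    S-dom    : ∀ {w x y} → S w x y → R w x × R w y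
    S-refl   : ∀ {w x} → R w x → S w x x
    S-trans  : ∀ {w x y z} → S w x y → S w y z → S w x z
    R⊆S      : ∀ {w x y} → R w x → R w y → R x y → S w x y

record Ultrafilter (W : Set) : Set₁ where
  field
    _∈U_    : Subset W → Set
    up      : ∀ {A B} → A ⊆ B → _∈U_ A → _∈U_ B
    inter   : ∀ {A B} → _∈U_ A → _∈U_ B → _∈U_ (A ∩ B)
    top     : _∈U_ (λ _ → ⊤)
    proper  : ¬ _∈U_ (λ _ → ⊥)
    ultra   : ∀ A → _∈U_ A ⊎ _∈U_ (∁ A)

open Ultrafilter public

Family : Set → Set₁
Family W = Pred (Subset W) 0ℓ

NonemptyMembers : ∀ {W} → Family W → Set₁
NonemptyMembers {W} l = ∀ A → l A → ∃ λ w → A w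

FIP : ∀ {W} → Family W → Set₁
FIP {W} l = ∀ (Ss : List (Subset W)) → All l Ss → ∃ λ w → All (λ S → S w) Ss

module _ (F : VeltmanFrame) where
  open VeltmanFrame F

  Box : Subset W → Subset W
  Box Y x = ∀ y → R x y → Y y

  Sinv : Subset W → Subset W → Subset W
  Sinv X Y w = ∀ x → X x → R w x → Σ W λ y → Y y × S w x y

  UnionCompl : List (Subset W) → Subset W
  UnionCompl []       x = ⊥
  UnionCompl (S ∷ Ss) x = (¬ S x) ⊎ UnionCompl Ss x

  Prec : Family W → Ultrafilter W → Ultrafilter W → Set₁
  Prec l f g = ∀ (A : Subset W) (Ss : List (Subset W)) → All l Ss →
               (f ∈U Sinv (∁ A) (UnionCompl Ss)) →
               (g ∈U A) × (g ∈U Box A)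

{-# OPTIONS --safe #-}
-- If f ≺_l g then R̂⁻¹(A) ∈ g whenever S⁻¹(Ā, ⋃ S̄ᵢ) ∈ f. Every point of R̂⁻¹(A)
-- vacuously lies in S⁻¹(Ā, ∅), since it has no R-successor outside A; so
-- S⁻¹(Ā, ∅) ∈ g, and g ≺_m h applied to the empty subfamily of m gives A ∈ h
-- and R̂⁻¹(A) ∈ h.
module Submission where

open import Data.Empty using (⊥-elim)
open import Data.List using ([])
open import Data.List.Relation.Unary.All using ([])
open import Data.Product using (_×_; proj₂)
open import Relation.Unary using (_⊆_; ∁)

open import Defs

module _ (F : VeltmanFrame) where
  open VeltmanFrame F

  Box⊆Sinv-∁ : ∀ {A Y : Subset W} → Box F A ⊆ Sinv F (∁ A) Y
  Box⊆Sinv-∁ w∈□A x x∉A wRx = ⊥-elim (x∉A (w∈□A x wRx))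

  Prec-Box : ∀ (m : Family W) (g h : Ultrafilter W) {A : Subset W} →
             Prec F m g h → g ∈U Box F A → (h ∈U A) × (h ∈U Box F A)
  Prec-Box _ g _ {A} g≺h □A∈g = g≺h A [] [] (up g Box⊆Sinv-∁ □A∈g)

  Prec-trans : ∀ (l m : Family W) (f g h : Ultrafilter W) →
               Prec F l f g → Prec F m g h → Prec F l f h
  Prec-trans _ m _ g h f≺g g≺h A Ss Ss∈l Sinv∈f =
    Prec-Box m g h g≺h (proj₂ (f≺g A Ss Ss∈l Sinv∈f))

lemma5p4 : (F : VeltmanFrame) (f g h : Ultrafilter (VeltmanFrame.W F))
    (l m : Family (VeltmanFrame.W F)) →
    NonemptyMembers l → FIP l → NonemptyMembers m → FIP m →
    Prec F l f g → Prec F m g h → Prec F l f h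
lemma5p4 F f g h l m _ _ _ _ = Prec-trans F l m f g h
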